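{- Let $(A,B)$ be a bimatrix game with $A,B\in\mathbb{Q}^{n\times n}$ and let $G$ be its associated graph. If $(x,y)$ is a minimal Nash equilibrium of $(A,B)$ such that $A_{S(x),S(y)}\ne\mathbf{0}$ or $B_{S(x),S(y)}\ne\mathbf{0}$, and such that both players receive non-negative payoffs ($x^TAy\ge0$ and $x^TBy\ge0$), then the subgraph of $G$ induced by $N[S(x)\cup S(y)]$ is connected.
   Context: Bimatrix game: the row player picks a probability vector $x$ over rows $[n]$, the column player a probability vector $y$ over columns $[n]$; payoffs $x^TAy$ and $x^TBy$. $(x,y)$ is a Nash equilibrium if neither player can strictly increase his payoff by unilaterally changing strategy. $S(x)=\{i:x_i>0\}$ is the support. A Nash equilibrium $(x,y)$ is minimal if every Nash equilibrium $(x',y')$ with $S(x')\subseteq S(x)$ and $S(y')\subseteq S(y)$ satisfies $S(x')=S(x)$ and $S(y')=S(y)$. For $I,J\subseteq[n]$, $A_{I,J}$ is the submatrix with rows $I$ and columns $J$. The associated graph $G$ is bipartite with row vertices $V_r=[n]$ and column vertices $V_c=[n]$, row $i$ adjacent to column $j$ iff $A_{i,j}\ne0$ or $B_{i,j}\ne0$; $S(x)$ is viewed as a set of row vertices, $S(y)$ as a set of column vertices, and $N[X]$ denotes the closed neighborhood of a vertex set $X$ in $G$. -}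

module Defs where

open import Data.Nat using (ℕ; zero; suc)
open import Data.Fin using (Fin; zero; suc)
open import Data.Rational using (ℚ; 0ℚ; 1ℚ; _+_; _*_; _≤_; _<_)
open import Data.Sum using (_⊎_; inj₁; inj₂)
open import Data.Product using (Σ; ∃; ∃-syntax; _×_; _,_)
open import Relation.Binary.PropositionalEquality using (_≡_; _≢_)

Matrix : ℕ → Set
Matrix n = Fin n → Fin n → ℚ

Vector : ℕ → Set
Vector n = Fin n → ℚ

sumℚ : ∀ {n} → (Fin n → ℚ) → ℚ
sumℚ {zero}  f = 0ℚ
sumℚ {suc n} f = f zero + sumℚ (λ i → f (suc i))

IsStrategy : ∀ {n} → Vector n → Set
IsStrategy x = (∀ i → 0ℚ ≤ x i) × (sumℚ x ≡ 1ℚ)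

payoff : ∀ {n} → Vector n → Matrix n → Vector n → ℚ
payoff x M y = sumℚ (λ i → sumℚ (λ j → x i * M i j * y j))

IsNash : ∀ {n} → Matrix n → Matrix n → Vector n → Vector n → Set
IsNash A B x y =
  IsStrategy x × IsStrategy y ×
  (∀ x' → IsStrategy x' → payoff x' A y ≤ payoff x A y) ×
  (∀ y' → IsStrategy y' → payoff x B y' ≤ payoff x B y)

InSupp : ∀ {n} → Vector n → Fin n → Set
InSupp x i = 0ℚ < x i

_⊆Supp_ : ∀ {n} → Vector n → Vector n → Set
x' ⊆Supp x = ∀ i → InSupp x' i → InSupp x i

IsMinimalNash : ∀ {n} → Matrix n → Matrix n → Vector n → Vector n → Set
IsMinimalNash A B x y =
  IsNash A B x y ×
  (∀ x' y' → IsNash A B x' y' → x' ⊆Supp x → y' ⊆Supp y →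
     (x ⊆Supp x') × (y ⊆Supp y'))

SubmatrixNonzero : ∀ {n} → Matrix n → Vector n → Vector n → Set
SubmatrixNonzero M x y = ∃[ i ] ∃[ j ] (InSupp x i × InSupp y j × M i j ≢ 0ℚ)

-- Associated bipartite graph G: vertices inj₁ i (row i) and inj₂ j (column j).
Vertex : ℕ → Set
Vertex n = Fin n ⊎ Fin n

data Adj {n} (A B : Matrix n) : Vertex n → Vertex n → Set where
  row-col : ∀ i j → (A i j ≢ 0ℚ ⊎ B i j ≢ 0ℚ) → Adj A B (inj₁ i) (inj₂ j)
  col-row : ∀ i j → (A i j ≢ 0ℚ ⊎ B i j ≢ 0ℚ) → Adj A B (inj₂ j) (inj₁ i)

SuppSet : ∀ {n} → Vector n → Vector n → Vertex n → Set
SuppSet x y (inj₁ i) = InSupp x i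
SuppSet x y (inj₂ j) = InSupp y j

ClosedNbhd : ∀ {n} → Matrix n → Matrix n → (Vertex n → Set) → Vertex n → Set
ClosedNbhd A B X v = X v ⊎ (∃[ u ] (X u × Adj A B u v))

data Walk {n} (A B : Matrix n) (P : Vertex n → Set) : Vertex n → Vertex n → Set where
  here : ∀ {u} → P u → Walk A B P u u
  step : ∀ {u w v} → P u → Adj A B u w → Walk A B P w v → Walk A B P u v

InducedConnected : ∀ {n} → Matrix n → Matrix n → (Vertex n → Set) → Set
InducedConnected A B P = ∀ u v → P u → P v → Walk A B P u v

module Submission where

-- Let (x,y) be a minimal Nash equilibrium with nonnegative payoffs, S = S(x) ∪ S(y)
-- and P = N[S].  The hypothesis on the submatrices gives a supported row i0 adjacent
-- to a supported column j0; let K be the component of i0 in the subgraph induced by P.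
-- Since K is closed under edges inside P, the game splits along K on the supports:
-- restricting x and y to K and renormalising keeps every row (column) payoff in K up
-- to a common factor and gives 0 outside K, which is no better than the nonnegative
-- equilibrium payoff.  So the restriction is an equilibrium with smaller support, and
-- minimality yields S ⊆ K, hence P ⊆ K, hence P is connected (walks through i0).

open import Defs
open import Data.Nat as ℕ using (ℕ; zero; suc)
import Data.Nat.Properties as ℕₚ
open import Data.Fin using (Fin; zero; suc; join; splitAt)
open import Data.Fin.Properties using (splitAt-join; join-splitAt; any?; suc-injective)
open import Data.Fin.Subset using (Subset; _∈_; _⊆_; ∣_∣; ⁅_⁆)
open import Data.Fin.Subset.Properties using (_∈?_; _⊂?_; p⊂q⇒∣p∣<∣q∣; ∣p∣≤n; x∈⁅x⁆; x∈⁅y⁆⇒x≡y)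
open import Data.Vec using (tabulate)
open import Data.Vec.Properties using (lookup∘tabulate; []=⇒lookup; lookup⇒[]=)
open import Data.Bool using (true)
open import Data.Rational using (ℚ; 0ℚ; 1ℚ; _+_; _*_; _≤_; _<_; 1/_; nonNegative; positive)
open import Data.Rational.Properties
open import Data.Rational.Solver using (module +-*-Solver)
open import Function using (_∘_)
open import Data.Sum using (_⊎_; inj₁; inj₂)
open import Data.Product using (∃; ∃-syntax; _×_; _,_; proj₁; proj₂)
open import Relation.Binary.PropositionalEquality
open import Relation.Nullary using (Dec; yes; no; ¬_; does; contradiction)
open import Relation.Nullary.Decidable using (dec-true; decidable-stable; map′; ¬?; _×-dec_; _⊎-dec_)

open +-*-Solver using (solve; _:+_; _:*_; _:=_)

*-nonNeg : ∀ {a b} → 0ℚ ≤ a → 0ℚ ≤ b → 0ℚ ≤ a * b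
*-nonNeg {a} {b} 0≤a 0≤b =
  nonNegative⁻¹ _ {{nonNeg*nonNeg⇒nonNeg a {{nonNegative 0≤a}} b {{nonNegative 0≤b}}}}

*-monoˡ-nonNeg : ∀ {a b} c → 0ℚ ≤ c → a ≤ b → c * a ≤ c * b
*-monoˡ-nonNeg c 0≤c = *-monoˡ-≤-nonNeg c {{nonNegative 0≤c}}

*-monoʳ-nonNeg : ∀ {a b} c → 0ℚ ≤ c → a ≤ b → a * c ≤ b * c
*-monoʳ-nonNeg c 0≤c = *-monoʳ-≤-nonNeg c {{nonNegative 0≤c}}

nonNeg-cases : ∀ {a} → 0ℚ ≤ a → (0ℚ < a) ⊎ (a ≡ 0ℚ)
nonNeg-cases {a} 0≤a with 0ℚ <? a
... | yes 0<a = inj₁ 0<a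
... | no 0≮a  = inj₂ (≤-antisym (≮⇒≥ 0≮a) 0≤a)

reciprocal : ∀ α → 0ℚ < α → ∃[ a ] (0ℚ ≤ a × α * a ≡ 1ℚ)
reciprocal α 0<α =
  (1/ α) {{α≢0}} , <⇒≤ (positive⁻¹ _ {{1/pos⇒pos α {{positive 0<α}}}}) , *-inverseʳ α {{α≢0}}
  where α≢0 = pos⇒nonZero α {{positive 0<α}}

sum-cong : ∀ {n} {f g : Fin n → ℚ} → (∀ i → f i ≡ g i) → sumℚ f ≡ sumℚ g
sum-cong {zero}  f≗g = refl
sum-cong {suc n} f≗g = cong₂ _+_ (f≗g zero) (sum-cong (f≗g ∘ suc))

sum-+ : ∀ {n} (f g : Fin n → ℚ) → sumℚ (λ i → f i + g i) ≡ sumℚ f + sumℚ g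
sum-+ {zero}  f g = refl
sum-+ {suc n} f g rewrite sum-+ (λ i → f (suc i)) (λ i → g (suc i)) =
  solve 4 (λ a b c d → (a :+ b) :+ (c :+ d) := (a :+ c) :+ (b :+ d)) refl
    (f zero) (g zero) (sumℚ (λ i → f (suc i))) (sumℚ (λ i → g (suc i)))

sum-*ˡ : ∀ {n} c (f : Fin n → ℚ) → sumℚ (λ i → c * f i) ≡ c * sumℚ f
sum-*ˡ {zero}  c f = sym (*-zeroʳ c)
sum-*ˡ {suc n} c f rewrite sum-*ˡ c (λ i → f (suc i)) = sym (*-distribˡ-+ c (f zero) _)

sum-*ʳ : ∀ {n} c (f : Fin n → ℚ) → sumℚ (λ i → f i * c) ≡ sumℚ f * c
sum-*ʳ c f = trans (sum-cong (λ i → *-comm (f i) c)) (trans (sum-*ˡ c f) (*-comm c _))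

sum-zero : ∀ {n} (f : Fin n → ℚ) → (∀ i → f i ≡ 0ℚ) → sumℚ f ≡ 0ℚ
sum-zero {zero}  f f≗0 = refl
sum-zero {suc n} f f≗0 rewrite f≗0 zero | sum-zero (λ i → f (suc i)) (λ i → f≗0 (suc i)) = refl

sum-mono : ∀ {n} {f g : Fin n → ℚ} → (∀ i → f i ≤ g i) → sumℚ f ≤ sumℚ g
sum-mono {zero}  f≤g = ≤-refl
sum-mono {suc n} f≤g = +-mono-≤ (f≤g zero) (sum-mono (λ i → f≤g (suc i)))

sum-mono-< : ∀ {n} {f g : Fin n → ℚ} → (∀ i → f i ≤ g i) → ∀ k → f k < g k → sumℚ f < sumℚ g
sum-mono-< {suc n} f≤g zero    fk<gk = +-mono-<-≤ fk<gk (sum-mono (λ i → f≤g (suc i)))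
sum-mono-< {suc n} f≤g (suc k) fk<gk = +-mono-≤-< (f≤g zero) (sum-mono-< (λ i → f≤g (suc i)) k fk<gk)

sum-≤-≡ : ∀ {n} {f g : Fin n → ℚ} → (∀ i → f i ≤ g i) → sumℚ f ≡ sumℚ g → ∀ k → f k ≡ g k
sum-≤-≡ {f = f} {g} f≤g Σf≡Σg k with f k <? g k
... | yes fk<gk = contradiction Σf≡Σg (<⇒≢ (sum-mono-< f≤g k fk<gk))
... | no fk≮gk  = ≤-antisym (f≤g k) (≮⇒≥ fk≮gk)

sum-nonNeg : ∀ {n} {f : Fin n → ℚ} → (∀ i → 0ℚ ≤ f i) → 0ℚ ≤ sumℚ f
sum-nonNeg {zero}  0≤f = ≤-refl
sum-nonNeg {suc n} 0≤f =
  ≤-trans (≤-reflexive (sym (+-identityʳ 0ℚ))) (+-mono-≤ (0≤f zero) (sum-nonNeg (λ i → 0≤f (suc i))))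

term≤sum : ∀ {n} {f : Fin n → ℚ} → (∀ i → 0ℚ ≤ f i) → ∀ k → f k ≤ sumℚ f
term≤sum {suc n} {f} 0≤f zero =
  ≤-trans (≤-reflexive (sym (+-identityʳ (f zero)))) (+-mono-≤ (≤-refl {f zero}) (sum-nonNeg (λ i → 0≤f (suc i))))
term≤sum {suc n} 0≤f (suc k) =
  ≤-trans (term≤sum (λ i → 0≤f (suc i)) k) (≤-trans (≤-reflexive (sym (+-identityˡ _))) (+-mono-≤ (0≤f zero) ≤-refl))

sum-single : ∀ {n} (f : Fin n → ℚ) k → (∀ i → i ≢ k → f i ≡ 0ℚ) → sumℚ f ≡ f k
sum-single {suc n} f zero    off rewrite sum-zero (λ i → f (suc i)) (λ i → off (suc i) λ ()) = +-identityʳ (f zero)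
sum-single {suc n} f (suc k) off
  rewrite off zero (λ ())
        | sum-single (λ i → f (suc i)) k (λ i i≢k → off (suc i) (i≢k ∘ suc-injective)) = +-identityˡ _

sum-swap : ∀ {n m} (f : Fin n → Fin m → ℚ) →
  sumℚ (λ i → sumℚ (λ j → f i j)) ≡ sumℚ (λ j → sumℚ (λ i → f i j))
sum-swap {zero} {m} f = sym (sum-zero {m} _ (λ _ → refl))
sum-swap {suc n} f rewrite sum-swap (λ i j → f (suc i) j) =
  sym (sum-+ (λ j → f zero j) (λ j → sumℚ (λ i → f (suc i) j)))

-- Best responses

rowPayoff : ∀ {n} → Matrix n → Vector n → Fin n → ℚ
rowPayoff M q i = sumℚ (λ j → M i j * q j)

payoff-rowPayoff : ∀ {n} (p : Vector n) M q → payoff p M q ≡ sumℚ (λ i → p i * rowPayoff M q i)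
payoff-rowPayoff p M q =
  sum-cong (λ i → trans (sum-cong (λ j → *-assoc (p i) (M i j) (q j))) (sum-*ˡ (p i) (λ j → M i j * q j)))

pure : ∀ {n} → Fin n → Vector n
pure k i with i Data.Fin.≟ k
... | yes _ = 1ℚ
... | no _  = 0ℚ

pure-off : ∀ {n} (k i : Fin n) → i ≢ k → pure k i ≡ 0ℚ
pure-off k i i≢k with i Data.Fin.≟ k
... | yes i≡k = contradiction i≡k i≢k
... | no _    = refl

pure-on : ∀ {n} (k : Fin n) → pure k k ≡ 1ℚ
pure-on k with k Data.Fin.≟ k
... | yes _   = refl
... | no k≢k  = contradiction refl k≢k

pure-isStrategy : ∀ {n} (k : Fin n) → IsStrategy (pure k)
pure-isStrategy k = nonNeg , trans (sum-single (pure k) k (pure-off k)) (pure-on k)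
  where
  nonNeg : ∀ i → 0ℚ ≤ pure k i
  nonNeg i with i Data.Fin.≟ k
  ... | yes _ = nonNegative⁻¹ 1ℚ
  ... | no _  = ≤-refl

payoff-pure : ∀ {n} (k : Fin n) M q → payoff (pure k) M q ≡ rowPayoff M q k
payoff-pure k M q = begin
  payoff (pure k) M q                        ≡⟨ payoff-rowPayoff (pure k) M q ⟩
  sumℚ (λ i → pure k i * rowPayoff M q i)    ≡⟨ sum-single _ k (λ i i≢k → trans (cong (_* rowPayoff M q i) (pure-off k i i≢k)) (*-zeroˡ (rowPayoff M q i))) ⟩
  pure k k * rowPayoff M q k                 ≡⟨ cong (_* rowPayoff M q k) (pure-on k) ⟩
  1ℚ * rowPayoff M q k                       ≡⟨ *-identityˡ _ ⟩
  rowPayoff M q k                            ∎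
  where open ≡-Reasoning

BestResponse : ∀ {n} → Vector n → Matrix n → Vector n → Set
BestResponse p M q = ∀ p' → IsStrategy p' → payoff p' M q ≤ payoff p M q

bestResponse-pure : ∀ {n} {p : Vector n} {M q} → BestResponse p M q → ∀ k → rowPayoff M q k ≤ payoff p M q
bestResponse-pure {p = p} {M} {q} best k = ≤-trans (≤-reflexive (sym (payoff-pure k M q))) (best (pure k) (pure-isStrategy k))

payoff-bound : ∀ {n} {M : Matrix n} {q : Vector n} {c} → (∀ k → rowPayoff M q k ≤ c) →
  ∀ p → IsStrategy p → payoff p M q ≤ c
payoff-bound {M = M} {q} {c} bound p (0≤p , Σp≡1) = begin
  payoff p M q                           ≡⟨ payoff-rowPayoff p M q ⟩
  sumℚ (λ i → p i * rowPayoff M q i)     ≤⟨ sum-mono (λ i → *-monoˡ-nonNeg (p i) (0≤p i) (bound i)) ⟩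
  sumℚ (λ i → p i * c)                   ≡⟨ sum-*ʳ c p ⟩
  sumℚ p * c                             ≡⟨ cong (_* c) Σp≡1 ⟩
  1ℚ * c                                 ≡⟨ *-identityˡ c ⟩
  c                                      ∎
  where open ≤-Reasoning

indifference : ∀ {n} {p : Vector n} {M q} → IsStrategy p → BestResponse p M q →
  ∀ i → p i * rowPayoff M q i ≡ p i * payoff p M q
indifference {p = p} {M} {q} (0≤p , Σp≡1) best =
  sum-≤-≡ (λ i → *-monoˡ-nonNeg (p i) (0≤p i) (bestResponse-pure {p = p} best i)) (begin
    sumℚ (λ i → p i * rowPayoff M q i)  ≡⟨ sym (payoff-rowPayoff p M q) ⟩
    payoff p M q                        ≡⟨ sym (*-identityˡ _) ⟩
    1ℚ * payoff p M q                   ≡⟨ cong (_* payoff p M q) (sym Σp≡1) ⟩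
    sumℚ p * payoff p M q               ≡⟨ sym (sum-*ʳ (payoff p M q) p) ⟩
    sumℚ (λ i → p i * payoff p M q)     ∎)
  where open ≡-Reasoning

transpose : ∀ {n} → Matrix n → Matrix n
transpose M j i = M i j

payoff-transpose : ∀ {n} (x : Vector n) (M : Matrix n) (y : Vector n) → payoff x M y ≡ payoff y (transpose M) x
payoff-transpose {n} x M y = trans (sum-swap {n} {n} (λ i j → x i * M i j * y j))
  (sum-cong (λ j → sum-cong (λ i → solve 3 (λ a m b → a :* m :* b := b :* m :* a) refl (x i) (M i j) (y j))))

-- Restricting a strategy to a decidable set of pure strategies

mask : ∀ {n} {C : Fin n → Set} → (∀ i → Dec (C i)) → Vector n → Vector n
mask C? p i with C? i
... | yes _ = p i
... | no _  = 0ℚ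

mask-inside : ∀ {n} {C : Fin n → Set} (C? : ∀ i → Dec (C i)) p {i} → C i → mask C? p i ≡ p i
mask-inside C? p {i} c with C? i
... | yes _ = refl
... | no ¬c = contradiction c ¬c

mask-nonNeg : ∀ {n} {C : Fin n → Set} (C? : ∀ i → Dec (C i)) {p : Vector n} →
  (∀ i → 0ℚ ≤ p i) → ∀ i → 0ℚ ≤ mask C? p i
mask-nonNeg C? 0≤p i with C? i
... | yes _ = 0≤p i
... | no _  = ≤-refl

mass : ∀ {n} {C : Fin n → Set} → (∀ i → Dec (C i)) → Vector n → ℚ
mass C? p = sumℚ (mask C? p)

mass-pos : ∀ {n} {C : Fin n → Set} (C? : ∀ i → Dec (C i)) {p : Vector n} →
  (∀ i → 0ℚ ≤ p i) → ∀ {k} → C k → 0ℚ < p k → 0ℚ < mass C? p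
mass-pos C? {p} 0≤p {k} c 0<pk =
  <-≤-trans (subst (0ℚ <_) (sym (mask-inside C? p c)) 0<pk) (term≤sum (mask-nonNeg C? 0≤p) k)

rescale : ∀ {n} {C : Fin n → Set} → (∀ i → Dec (C i)) → Vector n → ℚ → Vector n
rescale C? p a i = mask C? p i * a

Normalises : ∀ {n} {C : Fin n → Set} → (∀ i → Dec (C i)) → Vector n → ℚ → Set
Normalises C? p a = 0ℚ ≤ a × mass C? p * a ≡ 1ℚ

normaliser : ∀ {n} {C : Fin n → Set} (C? : ∀ i → Dec (C i)) p → 0ℚ < mass C? p → ∃[ a ] Normalises C? p a
normaliser C? p 0<mass = reciprocal (mass C? p) 0<mass

rescale-isStrategy : ∀ {n} {C : Fin n → Set} (C? : ∀ i → Dec (C i)) {p a} →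
  (∀ i → 0ℚ ≤ p i) → Normalises C? p a → IsStrategy (rescale C? p a)
rescale-isStrategy C? {p} {a} 0≤p (0≤a , mass*a≡1) =
  (λ i → *-nonNeg (mask-nonNeg C? 0≤p i) 0≤a) , trans (sum-*ʳ a (mask C? p)) mass*a≡1

rescale-⊆Supp : ∀ {n} {C : Fin n → Set} (C? : ∀ i → Dec (C i)) {p : Vector n} a →
  (∀ i → 0ℚ ≤ p i) → rescale C? p a ⊆Supp p
rescale-⊆Supp C? {p} a 0≤p i 0<p'i with nonNeg-cases (0≤p i)
... | inj₁ 0<pi = 0<pi
... | inj₂ pi≡0 = contradiction (sym p'i≡0) (<⇒≢ 0<p'i)
  where
  p'i≡0 : rescale C? p a i ≡ 0ℚ
  p'i≡0 with C? i
  ... | yes _ = trans (cong (_* a) pi≡0) (*-zeroˡ a)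
  ... | no _  = *-zeroˡ a

rescale-support : ∀ {n} {C : Fin n → Set} (C? : ∀ i → Dec (C i)) p a {i} → 0ℚ < rescale C? p a i → C i
rescale-support C? p a {i} 0<p'i with C? i
... | yes c = c
... | no _  = contradiction (sym (*-zeroˡ a)) (<⇒≢ 0<p'i)

-- Restricting an equilibrium to a separated block

Separates : ∀ {n} → Matrix n → (Fin n → Set) → (Fin n → Set) → Vector n → Set
Separates M Cp Cq q =
  ∀ i j → 0ℚ < q j → (Cp i → ¬ Cq j → M i j ≡ 0ℚ) × (¬ Cp i → Cq j → M i j ≡ 0ℚ)

-- If p is a best response to q with nonnegative payoff, then the renormalised
-- restriction of p to Cp is a best response to the rescaled restriction of q to Cq:
-- rows in Cp see their payoffs scaled by b, rows outside Cp earn 0.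
module BlockRestriction {n} {Cp Cq : Fin n → Set} (Cp? : ∀ i → Dec (Cp i)) (Cq? : ∀ j → Dec (Cq j))
  {M : Matrix n} {p q : Vector n} {a b : ℚ}
  (p-strategy : IsStrategy p) (q-strategy : IsStrategy q) (best : BestResponse p M q)
  (0≤value : 0ℚ ≤ payoff p M q) (separated : Separates M Cp Cq q)
  (normalised : Normalises Cp? p a) (0≤b : 0ℚ ≤ b) where

  private
    value = payoff p M q
    p' = rescale Cp? p a
    q' = rescale Cq? q b

  vanishing-term : ∀ i j → (0ℚ < q j → M i j ≡ 0ℚ) → M i j * q j ≡ 0ℚ
  vanishing-term i j Mij≡0 with nonNeg-cases (proj₁ q-strategy j)
  ... | inj₁ 0<qj = trans (cong (_* q j) (Mij≡0 0<qj)) (*-zeroˡ (q j))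
  ... | inj₂ qj≡0 = trans (cong (M i j *_) qj≡0) (*-zeroʳ (M i j))

  rowPayoff-inside : ∀ {i} → Cp i → rowPayoff M q' i ≡ rowPayoff M q i * b
  rowPayoff-inside {i} ci = trans (sum-cong term) (sum-*ʳ b (λ j → M i j * q j))
    where
    term : ∀ j → M i j * (mask Cq? q j * b) ≡ M i j * q j * b
    term j with Cq? j
    ... | yes _   = sym (*-assoc (M i j) (q j) b)
    ... | no ¬cj  = begin
      M i j * (0ℚ * b)  ≡⟨ cong (M i j *_) (*-zeroˡ b) ⟩
      M i j * 0ℚ        ≡⟨ *-zeroʳ (M i j) ⟩
      0ℚ                ≡⟨ sym (*-zeroˡ b) ⟩
      0ℚ * b            ≡⟨ cong (_* b) (sym (vanishing-term i j (λ 0<qj → proj₁ (separated i j 0<qj) ci ¬cj))) ⟩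
      M i j * q j * b   ∎
      where open ≡-Reasoning

  rowPayoff-outside : ∀ {i} → ¬ Cp i → rowPayoff M q' i ≡ 0ℚ
  rowPayoff-outside {i} ¬ci = sum-zero _ term
    where
    term : ∀ j → M i j * (mask Cq? q j * b) ≡ 0ℚ
    term j with Cq? j
    ... | no _   = trans (cong (M i j *_) (*-zeroˡ b)) (*-zeroʳ (M i j))
    ... | yes cj = trans (sym (*-assoc (M i j) (q j) b))
      (trans (cong (_* b) (vanishing-term i j (λ 0<qj → proj₂ (separated i j 0<qj) ¬ci cj))) (*-zeroˡ b))

  -- Each row's contribution to the restricted payoff, via indifference on the support of p.
  restricted-term : ∀ i → p' i * rowPayoff M q' i ≡ mask Cp? p i * value * (a * b)
  restricted-term i with Cp? i
  ... | yes ci = begin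
    p i * a * rowPayoff M q' i       ≡⟨ cong (p i * a *_) (rowPayoff-inside ci) ⟩
    p i * a * (rowPayoff M q i * b)  ≡⟨ solve 4 (λ x a r b → (x :* a) :* (r :* b) := (x :* r) :* (a :* b)) refl (p i) a (rowPayoff M q i) b ⟩
    p i * rowPayoff M q i * (a * b)  ≡⟨ cong (_* (a * b)) (indifference p-strategy best i) ⟩
    p i * value * (a * b)            ∎
    where open ≡-Reasoning
  ... | no _ = begin
    0ℚ * a * rowPayoff M q' i   ≡⟨ cong (_* rowPayoff M q' i) (*-zeroˡ a) ⟩
    0ℚ * rowPayoff M q' i       ≡⟨ *-zeroˡ (rowPayoff M q' i) ⟩
    0ℚ                          ≡⟨ sym (*-zeroˡ (a * b)) ⟩
    0ℚ * (a * b)                ≡⟨ cong (_* (a * b)) (sym (*-zeroˡ value)) ⟩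
    0ℚ * value * (a * b)        ∎
    where open ≡-Reasoning

  restricted-payoff : payoff p' M q' ≡ value * b
  restricted-payoff = begin
    payoff p' M q'                                  ≡⟨ payoff-rowPayoff p' M q' ⟩
    sumℚ (λ i → p' i * rowPayoff M q' i)            ≡⟨ sum-cong restricted-term ⟩
    sumℚ (λ i → mask Cp? p i * value * (a * b))     ≡⟨ sum-*ʳ (a * b) (λ i → mask Cp? p i * value) ⟩
    sumℚ (λ i → mask Cp? p i * value) * (a * b)     ≡⟨ cong (_* (a * b)) (sum-*ʳ value (mask Cp? p)) ⟩
    mass Cp? p * value * (a * b)                    ≡⟨ solve 4 (λ s v a b → (s :* v) :* (a :* b) := (s :* a) :* (v :* b)) refl (mass Cp? p) value a b ⟩
    mass Cp? p * a * (value * b)                    ≡⟨ cong (_* (value * b)) (proj₂ normalised) ⟩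
    1ℚ * (value * b)                                ≡⟨ *-identityˡ _ ⟩
    value * b                                       ∎
    where open ≡-Reasoning

  -- No pure row earns more than value * b; rows outside Cp use 0 ≤ value.
  restricted-rowPayoff-bound : ∀ k → rowPayoff M q' k ≤ value * b
  restricted-rowPayoff-bound k with Cp? k
  ... | yes ck = ≤-trans (≤-reflexive (rowPayoff-inside ck)) (*-monoʳ-nonNeg b 0≤b (bestResponse-pure {p = p} best k))
  ... | no ¬ck = ≤-trans (≤-reflexive (rowPayoff-outside ¬ck)) (*-nonNeg 0≤value 0≤b)

  restriction-bestResponse : BestResponse p' M q'
  restriction-bestResponse p'' p''-strategy =
    ≤-trans (payoff-bound restricted-rowPayoff-bound p'' p''-strategy) (≤-reflexive (sym restricted-payoff))

ColumnBest : ∀ {n} → Vector n → Matrix n → Vector n → Set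
ColumnBest x B y = ∀ y' → IsStrategy y' → payoff x B y' ≤ payoff x B y

columnBest⇒bestResponse : ∀ {n} {x : Vector n} {B y} → ColumnBest x B y → BestResponse y (transpose B) x
columnBest⇒bestResponse {x = x} {B} {y} best y' s =
  subst₂ _≤_ (payoff-transpose x B y') (payoff-transpose x B y) (best y' s)

bestResponse⇒columnBest : ∀ {n} {x : Vector n} {B y} → BestResponse y (transpose B) x → ColumnBest x B y
bestResponse⇒columnBest {x = x} {B} {y} best y' s =
  subst₂ _≤_ (sym (payoff-transpose x B y')) (sym (payoff-transpose x B y)) (best y' s)

restriction-isNash : ∀ {n} {A B : Matrix n} {x y : Vector n} {Cp Cq : Fin n → Set}
  (Cp? : ∀ i → Dec (Cp i)) (Cq? : ∀ j → Dec (Cq j)) {a b : ℚ} →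
  IsNash A B x y → 0ℚ ≤ payoff x A y → 0ℚ ≤ payoff x B y →
  Separates A Cp Cq y → Separates (transpose B) Cq Cp x →
  Normalises Cp? x a → Normalises Cq? y b →
  IsNash A B (rescale Cp? x a) (rescale Cq? y b)
restriction-isNash {B = B} {x} {y} Cp? Cq? (x-strategy , y-strategy , rowBest , colBest)
  0≤rowValue 0≤colValue separatedA separatedBᵀ normalisedX normalisedY =
    rescale-isStrategy Cp? (proj₁ x-strategy) normalisedX
  , rescale-isStrategy Cq? (proj₁ y-strategy) normalisedY
  , BlockRestriction.restriction-bestResponse Cp? Cq? x-strategy y-strategy rowBest
      0≤rowValue separatedA normalisedX (proj₁ normalisedY)
  , bestResponse⇒columnBest (BlockRestriction.restriction-bestResponse Cq? Cp? y-strategy x-strategy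
      (columnBest⇒bestResponse colBest) (subst (0ℚ ≤_) (payoff-transpose x B y) 0≤colValue)
      separatedBᵀ normalisedY (proj₁ normalisedX))

-- Post-fixed points of inflationary operators on finite subsets

-- Iterating an inflationary operator F on subsets of Fin m from p reaches, after at
-- most m steps, a set q with F q ⊆ q; every invariant preserved by F holds for q.
postFixedPoint : ∀ {m} (F : Subset m → Subset m) → (∀ p → p ⊆ F p) →
  (Inv : Subset m → Set) → (∀ p → Inv p → Inv (F p)) →
  ∀ p → Inv p → ∃[ q ] (Inv q × F q ⊆ q)
postFixedPoint {m} F inflationary Inv preserved p inv = iterate m p (ℕₚ.m≤m+n m ∣ p ∣) inv
  where
  -- The fuel k bounds the number of strict enlargements still possible.
  iterate : ∀ k p → m ℕ.≤ k ℕ.+ ∣ p ∣ → Inv p → ∃[ q ] (Inv q × F q ⊆ q)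
  iterate k p bound inv with p ⊂? F p
  ... | no p⊄Fp = p , inv , stable
    where
    stable : F p ⊆ p
    stable {x} x∈Fp with x ∈? p
    ... | yes x∈p = x∈p
    ... | no x∉p  = contradiction ((λ {y} → inflationary p {y}) , x , x∈Fp , x∉p) p⊄Fp
  iterate zero    p bound inv | yes p⊂Fp =
    contradiction (ℕₚ.≤-trans (p⊂q⇒∣p∣<∣q∣ p⊂Fp) (∣p∣≤n (F p))) (ℕₚ.≤⇒≯ bound)
  iterate (suc k) p bound inv | yes p⊂Fp =
    iterate k (F p) (ℕₚ.≤-trans bound (ℕₚ.≤-trans (ℕₚ.≤-reflexive (sym (ℕₚ.+-suc k ∣ p ∣)))
      (ℕₚ.+-monoʳ-≤ k (p⊂q⇒∣p∣<∣q∣ p⊂Fp)))) (preserved p inv)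

-- The associated graph

-- Vertices are coded by Fin (n + n): rows first, then columns.
code : ∀ {n} → Vertex n → Fin (n ℕ.+ n)
code {n} = join n n

decode : ∀ {n} → Fin (n ℕ.+ n) → Vertex n
decode {n} = splitAt n

any-vertex? : ∀ {n} {Q : Vertex n → Set} → (∀ v → Dec (Q v)) → Dec (∃ Q)
any-vertex? {n} {Q} Q? =
  map′ (λ (k , q) → decode k , q) (λ (v , q) → code v , subst Q (sym (splitAt-join n n v)) q) (any? (Q? ∘ decode))

adj-sym : ∀ {n} {A B : Matrix n} {u v} → Adj A B u v → Adj A B v u
adj-sym (row-col i j nz) = col-row i j nz
adj-sym (col-row i j nz) = row-col i j nz

module Decidability {n} (A B : Matrix n) where

  nonzero? : ∀ i j → Dec (A i j ≢ 0ℚ ⊎ B i j ≢ 0ℚ)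
  nonzero? i j = ¬? (A i j ≟ 0ℚ) ⊎-dec ¬? (B i j ≟ 0ℚ)

  adj? : ∀ u v → Dec (Adj A B u v)
  adj? (inj₁ i) (inj₁ j) = no λ ()
  adj? (inj₂ j) (inj₂ i) = no λ ()
  adj? (inj₁ i) (inj₂ j) = map′ (row-col i j) (λ { (row-col _ _ nz) → nz }) (nonzero? i j)
  adj? (inj₂ j) (inj₁ i) = map′ (col-row i j) (λ { (col-row _ _ nz) → nz }) (nonzero? i j)

  closedNbhd? : ∀ {X : Vertex n → Set} → (∀ v → Dec (X v)) → ∀ v → Dec (ClosedNbhd A B X v)
  closedNbhd? X? v = X? v ⊎-dec any-vertex? (λ u → X? u ×-dec adj? u v)

suppSet? : ∀ {n} (x y : Vector n) v → Dec (SuppSet x y v)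
suppSet? x y (inj₁ i) = 0ℚ <? x i
suppSet? x y (inj₂ j) = 0ℚ <? y j

module WalkOps {n} {A B : Matrix n} {P : Vertex n → Set} where

  walk-snoc : ∀ {u v w} → Walk A B P u v → Adj A B v w → P w → Walk A B P u w
  walk-snoc (here pu)           v~w pw = step pu v~w (here pw)
  walk-snoc (step pu u~u' rest) v~w pw = step pu u~u' (walk-snoc rest v~w pw)

  walk-reverse : ∀ {u v} → Walk A B P u v → Walk A B P v u
  walk-reverse (here pu)          = here pu
  walk-reverse (step pu u~w rest) = walk-snoc (walk-reverse rest) (adj-sym u~w) pu

  walk-append : ∀ {u v w} → Walk A B P u v → Walk A B P v w → Walk A B P u w
  walk-append (here _)           rest = rest
  walk-append (step pu u~w walk) rest = step pu u~w (walk-append walk rest)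

open WalkOps

-- A decidable set of vertices of P, reachable from r inside P and closed under edges
-- into P: exactly the connected component of r in the subgraph induced by P.
record Component {n} (A B : Matrix n) (P : Vertex n → Set) (r : Vertex n) : Set₁ where
  field
    Member    : Vertex n → Set
    member?   : ∀ v → Dec (Member v)
    root      : Member r
    reachable : ∀ {v} → Member v → Walk A B P r v
    closed    : ∀ {u v} → Member u → P v → Adj A B u v → Member v

does-true : ∀ {Q : Set} (Q? : Dec Q) → does Q? ≡ true → Q
does-true (yes q) _ = q
does-true (no _)  ()

-- Every vertex of a decidable vertex set P has a component, computed breadth-first as
-- a post-fixed point of the operator adding all P-neighbours of the current set.
component : ∀ {n} (A B : Matrix n) {P : Vertex n → Set} → (∀ v → Dec (P v)) → ∀ {r} → P r → Component A B P r
component {n} A B {P} P? {r} pr = record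
  { Member    = λ v → code v ∈ K
  ; member?   = λ v → code v ∈? K
  ; root      = proj₁ (proj₁ (proj₂ fixed))
  ; reachable = proj₂ (proj₁ (proj₂ fixed))
  ; closed    = λ u∈K pv u~v → proj₂ (proj₂ fixed) (∈-grow⁺ (inj₂ (pv , _ , u∈K , u~v)))
  }
  where
  open Decidability A B

  Extends : Subset (n ℕ.+ n) → Vertex n → Set
  Extends p v = code v ∈ p ⊎ (P v × ∃[ u ] (code u ∈ p × Adj A B u v))

  extends? : ∀ p v → Dec (Extends p v)
  extends? p v = (code v ∈? p) ⊎-dec (P? v ×-dec any-vertex? (λ u → (code u ∈? p) ×-dec adj? u v))

  grow : Subset (n ℕ.+ n) → Subset (n ℕ.+ n)
  grow p = tabulate (λ k → does (extends? p (decode k)))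

  ∈-grow⁺ : ∀ {p v} → Extends p v → code v ∈ grow p
  ∈-grow⁺ {p} {v} e = lookup⇒[]= (code v) (grow p)
    (trans (lookup∘tabulate _ (code v)) (dec-true (extends? p _) (subst (Extends p) (sym (splitAt-join n n v)) e)))

  ∈-grow⁻ : ∀ {p v} → code v ∈ grow p → Extends p v
  ∈-grow⁻ {p} {v} v∈grow = subst (Extends p) (splitAt-join n n v)
    (does-true (extends? p _) (trans (sym (lookup∘tabulate _ (code v))) ([]=⇒lookup v∈grow)))

  inflationary : ∀ p → p ⊆ grow p
  inflationary p {k} k∈p = subst (_∈ grow p) (join-splitAt n n k)
    (∈-grow⁺ {v = decode k} (inj₁ (subst (_∈ p) (sym (join-splitAt n n k)) k∈p)))

  Reached : Subset (n ℕ.+ n) → Set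
  Reached p = code r ∈ p × (∀ {v} → code v ∈ p → Walk A B P r v)

  reached-grow : ∀ p → Reached p → Reached (grow p)
  reached-grow p (r∈p , walks) = inflationary p r∈p , walk-to
    where
    walk-to : ∀ {v} → code v ∈ grow p → Walk A B P r v
    walk-to v∈grow with ∈-grow⁻ v∈grow
    ... | inj₁ v∈p                  = walks v∈p
    ... | inj₂ (pv , _ , u∈p , u~v) = walk-snoc (walks u∈p) u~v pv

  reached-start : Reached ⁅ code r ⁆
  reached-start = x∈⁅x⁆ (code r) , λ {v} v∈start →
    subst (Walk A B P r) (code-injective (x∈⁅y⁆⇒x≡y (code r) v∈start)) (here pr)
    where
    code-injective : ∀ {u v : Vertex n} → code u ≡ code v → v ≡ u
    code-injective {u} {v} cu≡cv =
      trans (sym (splitAt-join n n v)) (trans (cong decode (sym cu≡cv)) (splitAt-join n n u))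

  fixed : ∃[ q ] (Reached q × grow q ⊆ q)
  fixed = postFixedPoint grow inflationary Reached reached-grow ⁅ code r ⁆ reached-start

  K : Subset (n ℕ.+ n)
  K = proj₁ fixed

component-connected : ∀ {n} {A B : Matrix n} {P r} (K : Component A B P r) →
  (∀ {v} → P v → Component.Member K v) → InducedConnected A B P
component-connected K P⊆K u v pu pv =
  walk-append (walk-reverse (reachable (P⊆K pu))) (reachable (P⊆K pv))
  where open Component K

module NeighbourhoodComponent {n} {A B : Matrix n} {x y : Vector n} {r}
  (K : Component A B (ClosedNbhd A B (SuppSet x y)) r) where

  open Component K

  -- A component of N[S] separates M whenever nonzero entries of M are edges from ρ i
  -- to κ j and supported q-coordinates are vertices of S: used with (ρ, κ) = (rows,
  -- columns) for A and y, and (columns, rows) for Bᵀ and x.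
  component-separates : (ρ κ : Fin n → Vertex n) (M : Matrix n) (q : Vector n) →
    (∀ j → 0ℚ < q j → SuppSet x y (κ j)) → (∀ i j → M i j ≢ 0ℚ → Adj A B (ρ i) (κ j)) →
    Separates M (Member ∘ ρ) (Member ∘ κ) q
  component-separates ρ κ M q supported edge i j 0<qj =
      (λ ρi∈K κj∉K → decidable-stable (M i j ≟ 0ℚ) λ Mij≢0 →
         κj∉K (closed ρi∈K (inj₁ (supported j 0<qj)) (edge i j Mij≢0)))
    , (λ ρi∉K κj∈K → decidable-stable (M i j ≟ 0ℚ) λ Mij≢0 →
         let back = adj-sym (edge i j Mij≢0) in
         ρi∉K (closed κj∈K (inj₂ (κ j , supported j 0<qj , back)) back))

  -- Minimality forces the support S into every component of N[S] on which both
  -- players put weight: the renormalised restriction to K is a smaller equilibrium.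
  support⊆component : IsMinimalNash A B x y → 0ℚ ≤ payoff x A y → 0ℚ ≤ payoff x B y →
    ∀ {i j} → 0ℚ < x i → Member (inj₁ i) → 0ℚ < y j → Member (inj₂ j) →
    ∀ {v} → SuppSet x y v → Member v
  support⊆component (nash , minimal) 0≤rowValue 0≤colValue 0<xi i∈K 0<yj j∈K = inside
    where
    x-nonNeg : ∀ i → 0ℚ ≤ x i
    x-nonNeg = proj₁ (proj₁ nash)

    y-nonNeg : ∀ j → 0ℚ ≤ y j
    y-nonNeg = proj₁ (proj₁ (proj₂ nash))

    rows? : ∀ i → Dec (Member (inj₁ i))
    rows? = member? ∘ inj₁

    cols? : ∀ j → Dec (Member (inj₂ j))
    cols? = member? ∘ inj₂

    normX : ∃[ a ] Normalises rows? x a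
    normX = normaliser rows? x (mass-pos rows? x-nonNeg i∈K 0<xi)

    normY : ∃[ b ] Normalises cols? y b
    normY = normaliser cols? y (mass-pos cols? y-nonNeg j∈K 0<yj)

    x' y' : Vector n
    x' = rescale rows? x (proj₁ normX)
    y' = rescale cols? y (proj₁ normY)

    restricted : IsNash A B x' y'
    restricted = restriction-isNash rows? cols? nash 0≤rowValue 0≤colValue
      (component-separates inj₁ inj₂ A y (λ _ 0<yj → 0<yj) (λ i j nz → row-col i j (inj₁ nz)))
      (component-separates inj₂ inj₁ (transpose B) x (λ _ 0<xi → 0<xi) (λ j i nz → col-row i j (inj₂ nz)))
      (proj₂ normX) (proj₂ normY)

    same-support : (x ⊆Supp x') × (y ⊆Supp y')
    same-support = minimal x' y' restricted
      (rescale-⊆Supp rows? (proj₁ normX) x-nonNeg) (rescale-⊆Supp cols? (proj₁ normY) y-nonNeg)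

    inside : ∀ {v} → SuppSet x y v → Member v
    inside {inj₁ i} 0<xi = rescale-support rows? x (proj₁ normX) (proj₁ same-support i 0<xi)
    inside {inj₂ j} 0<yj = rescale-support cols? y (proj₁ normY) (proj₂ same-support j 0<yj)

  nbhd⊆component : (∀ {v} → SuppSet x y v → Member v) → ∀ {v} → ClosedNbhd A B (SuppSet x y) v → Member v
  nbhd⊆component S⊆K (inj₁ v∈S)            = S⊆K v∈S
  nbhd⊆component S⊆K v∈N@(inj₂ (u , u∈S , u~v)) = closed (S⊆K u∈S) v∈N u~v

supported-edge : ∀ {n} {A B : Matrix n} {x y : Vector n} →
  SubmatrixNonzero A x y ⊎ SubmatrixNonzero B x y →
  ∃[ i ] ∃[ j ] (0ℚ < x i × 0ℚ < y j × Adj A B (inj₁ i) (inj₂ j))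
supported-edge (inj₁ (i , j , 0<xi , 0<yj , Aij≢0)) = i , j , 0<xi , 0<yj , row-col i j (inj₁ Aij≢0)
supported-edge (inj₂ (i , j , 0<xi , 0<yj , Bij≢0)) = i , j , 0<xi , 0<yj , row-col i j (inj₂ Bij≢0)

lemma4 : (n : ℕ) (A B : Matrix n) (x y : Vector n) →
    IsMinimalNash A B x y →
    (SubmatrixNonzero A x y ⊎ SubmatrixNonzero B x y) →
    0ℚ ≤ payoff x A y →
    0ℚ ≤ payoff x B y →
    InducedConnected A B (ClosedNbhd A B (SuppSet x y))
lemma4 n A B x y minimal nonzero 0≤rowValue 0≤colValue
  with i , j , 0<xi , 0<yj , i~j ← supported-edge nonzero =
  component-connected K (nbhd⊆component S⊆K)
  where
  K : Component A B (ClosedNbhd A B (SuppSet x y)) (inj₁ i)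
  K = component A B (Decidability.closedNbhd? A B (suppSet? x y)) (inj₁ 0<xi)

  open Component K
  open NeighbourhoodComponent K

  S⊆K : ∀ {v} → SuppSet x y v → Member v
  S⊆K = support⊆component minimal 0≤rowValue 0≤colValue 0<xi root 0<yj (closed root (inj₁ 0<yj) i~j)
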